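{- Let $\mathcal{C}$ be a category with finite products and weak equalisers in which every object is a choice object, and let $r\colon R\to X\times X$ and $s\colon S\to Y\times Y$ be pseudo-equivalence relations. (i) An arrow $f\colon X\to Y$ of $\mathcal{C}$ determines an arrow $[f]\colon r\to s$ in $\mathcal{C}_{ex}$ (i.e. there is $\hat f\colon R\to S$ with $s\hat f=(f\times f)r$) if and only if for all $x,x'\in X$, $x\sim_r x'$ implies $fx\sim_s fx'$. (ii) Two such arrows $[f],[g]\colon r\to s$ are equal in $\mathcal{C}_{ex}$ if and only if $fx\sim_s gx$ for all $x\in X$.
   Context: Global elements $x\colon1\to X$ are written $x\in X$; for an arrow $a\colon A\to X$, $x\in_a$ means some $u\in A$ has $au=x$; $a$ is surjective if $x\in_a$ for all $x$; an object is a choice object if every surjection onto it has a section. For $r\colon R\to X\times X$, $x\sim_r x'$ iff $\langle x,x'\rangle\in_r$. A pseudo-equivalence relation is an arrow $r=\langle r_1,r_2\rangle\colon R\to X\times X$ for which there exist (not necessarily unique) $\rho\colon X\to R$ with $r\rho=\langle1,1\rangle$, $\sigma\colon R\to R$ with $r\sigma=\langle r_2,r_1\rangle$, and $\tau\colon Q\to R$ with $r\tau=\langle r_1p_1,r_2p_2\rangle$ for $(Q,p_1,p_2)$ a weak pullback of $r_2,r_1$. The exact completion $\mathcal{C}_{ex}$ has pseudo-equivalence relations as objects; arrows $r\to s$ are equivalence classes $[f]$ of arrows $f\colon X\to Y$ admitting some $\hat f\colon R\to S$ with $s\hat f=(f\times f)r$, where $f$ and $g$ are identified iff there is $h\colon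 X\to S$ with $sh=\langle f,g\rangle$. -}

module Defs where

open import Level using (Level; _⊔_) renaming (suc to lsuc)
open import Data.Product using (Σ; _×_; _,_)
open import Relation.Binary.PropositionalEquality using (_≡_)

record Category (o ℓ : Level) : Set (lsuc (o ⊔ ℓ)) where
  infixr 9 _∘_
  field
    Obj : Set o
    Hom : Obj → Obj → Set ℓ
    id  : ∀ {A} → Hom A A
    _∘_ : ∀ {A B C} → Hom B C → Hom A B → Hom A C
    idˡ : ∀ {A B} (f : Hom A B) → id ∘ f ≡ f
    idʳ : ∀ {A B} (f : Hom A B) → f ∘ id ≡ f
    assoc : ∀ {A B C D} (h : Hom C D) (g : Hom B C) (f : Hom A B) →
            (h ∘ g) ∘ f ≡ h ∘ (g ∘ f)

module _ {o ℓ : Level} (C : Category o ℓ) where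
  open Category C

  record FiniteProducts : Set (o ⊔ ℓ) where
    infixr 7 _⊗_
    field
      ⊤ : Obj
      ! : ∀ {A} → Hom A ⊤
      !-unique : ∀ {A} (f : Hom A ⊤) → f ≡ !
      _⊗_ : Obj → Obj → Obj
      π₁ : ∀ {A B} → Hom (A ⊗ B) A
      π₂ : ∀ {A B} → Hom (A ⊗ B) B
      ⟨_,_⟩ : ∀ {Z A B} → Hom Z A → Hom Z B → Hom Z (A ⊗ B)
      π₁∘⟨⟩ : ∀ {Z A B} (f : Hom Z A) (g : Hom Z B) → π₁ ∘ ⟨ f , g ⟩ ≡ f
      π₂∘⟨⟩ : ∀ {Z A B} (f : Hom Z A) (g : Hom Z B) → π₂ ∘ ⟨ f , g ⟩ ≡ g
      ⟨⟩-unique : ∀ {Z A B} (f : Hom Z A) (g : Hom Z B) (h : Hom Z (A ⊗ B)) →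
                  π₁ ∘ h ≡ f → π₂ ∘ h ≡ g → h ≡ ⟨ f , g ⟩

    _⊗₁_ : ∀ {A B A' B'} → Hom A A' → Hom B B' → Hom (A ⊗ B) (A' ⊗ B')
    f ⊗₁ g = ⟨ f ∘ π₁ , g ∘ π₂ ⟩

  HasWeakEqualisers : Set (o ⊔ ℓ)
  HasWeakEqualisers =
    ∀ {A B} (f g : Hom A B) →
      Σ Obj λ E → Σ (Hom E A) λ e → (f ∘ e ≡ g ∘ e) ×
        (∀ {Z} (h : Hom Z A) → f ∘ h ≡ g ∘ h → Σ (Hom Z E) λ k → e ∘ k ≡ h)

  IsWeakPullback : ∀ {A B D Q} (f : Hom A D) (g : Hom B D) (p₁ : Hom Q A) (p₂ : Hom Q B) →
                   Set (o ⊔ ℓ)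
  IsWeakPullback {A} {B} f g p₁ p₂ =
    (f ∘ p₁ ≡ g ∘ p₂) ×
    (∀ {Z} (a : Hom Z A) (b : Hom Z B) → f ∘ a ≡ g ∘ b →
       Σ _ λ k → (p₁ ∘ k ≡ a) × (p₂ ∘ k ≡ b))

  module _ (P : FiniteProducts) where
    open FiniteProducts P

    _∈[_] : ∀ {A X} → Hom ⊤ X → Hom A X → Set ℓ
    _∈[_] {A} x a = Σ (Hom ⊤ A) λ u → a ∘ u ≡ x

    Surjective : ∀ {A X} → Hom A X → Set ℓ
    Surjective {X = X} a = ∀ (x : Hom ⊤ X) → x ∈[ a ]

    ChoiceObject : Obj → Set (o ⊔ ℓ)
    ChoiceObject X = ∀ {A} (a : Hom A X) → Surjective a →
                     Σ (Hom X A) λ t → a ∘ t ≡ id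

    Rel∼ : ∀ {R X} (r : Hom R (X ⊗ X)) → Hom ⊤ X → Hom ⊤ X → Set ℓ
    Rel∼ r x x' = ⟨ x , x' ⟩ ∈[ r ]

    IsPseudoEquivalence : ∀ {R X} → Hom R (X ⊗ X) → Set (o ⊔ ℓ)
    IsPseudoEquivalence {R} {X} r =
      (Σ (Hom X R) λ ρ → r ∘ ρ ≡ ⟨ id , id ⟩) ×
      (Σ (Hom R R) λ σ → r ∘ σ ≡ ⟨ r₂ , r₁ ⟩) ×
      (Σ Obj λ Q → Σ (Hom Q R) λ p₁ → Σ (Hom Q R) λ p₂ →
         IsWeakPullback r₂ r₁ p₁ p₂ ×
         Σ (Hom Q R) λ τ → r ∘ τ ≡ ⟨ r₁ ∘ p₁ , r₂ ∘ p₂ ⟩)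
      where
        r₁ = π₁ ∘ r
        r₂ = π₂ ∘ r

    IsExArrow : ∀ {R S X Y} (r : Hom R (X ⊗ X)) (s : Hom S (Y ⊗ Y)) → Hom X Y → Set ℓ
    IsExArrow {R} {S} r s f = Σ (Hom R S) λ f̂ → s ∘ f̂ ≡ (f ⊗₁ f) ∘ r

    ExIdentified : ∀ {S X Y} (s : Hom S (Y ⊗ Y)) → Hom X Y → Hom X Y → Set ℓ
    ExIdentified {S} {X} s f g = Σ (Hom X S) λ h → s ∘ h ≡ ⟨ f , g ⟩

-- Both parts are instances of one factorisation criterion.  For arrows
-- a : A → W and b : B → W, "b factors through a" (∃ k. a ∘ k ≡ b) always
-- implies "every point of b lies in the image of a" (b ∘ u ∈[ a ] for all
-- global elements u).  When B is a choice object the converse holds: the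
-- weak equaliser E of a ∘ π₁ and b ∘ π₂ on A ⊗ B is a weak pullback of a
-- and b, its projection to B is surjective by the pointwise hypothesis, and
-- a section of it yields the factorisation.
--
-- Part (i) is the criterion for a := s, b := (f ⊗₁ f) ∘ r (points of r are
-- exactly the pairs ⟨x , x'⟩ with x ∼ᵣ x'); part (ii) is the criterion for
-- a := s, b := ⟨ f , g ⟩.

module Submission where

open import Defs
open import Level using (Level)
open import Data.Product using (_×_; _,_; Σ; proj₁; proj₂)
open import Function.Bundles using (_⇔_; mk⇔)
open import Function.Construct.Composition using (_⇔-∘_)
open import Relation.Binary.PropositionalEquality

module Points {o ℓ : Level} (C : Category o ℓ) (P : FiniteProducts C) where
  open Category C
  open FiniteProducts P

  Point : Obj → Set ℓ
  Point = Hom ⊤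

  infix 4 _∈_
  _∈_ : ∀ {A X} → Point X → Hom A X → Set ℓ
  x ∈ a = _∈[_] C P x a

  FactorsThrough : ∀ {A B W} → Hom B W → Hom A W → Set ℓ
  FactorsThrough {A} {B} b a = Σ (Hom B A) λ k → a ∘ k ≡ b

  ⟨⟩∘ : ∀ {Z Z' A B} (f : Hom Z A) (g : Hom Z B) (h : Hom Z' Z) →
        ⟨ f , g ⟩ ∘ h ≡ ⟨ f ∘ h , g ∘ h ⟩
  ⟨⟩∘ f g h = ⟨⟩-unique _ _ _
    (trans (sym (assoc _ _ _)) (cong (_∘ h) (π₁∘⟨⟩ f g)))
    (trans (sym (assoc _ _ _)) (cong (_∘ h) (π₂∘⟨⟩ f g)))

  ⊗₁∘⟨⟩ : ∀ {Z A B A' B'} (f : Hom A A') (g : Hom B B') (x : Hom Z A) (y : Hom Z B) →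
          (f ⊗₁ g) ∘ ⟨ x , y ⟩ ≡ ⟨ f ∘ x , g ∘ y ⟩
  ⊗₁∘⟨⟩ f g x y = trans (⟨⟩∘ _ _ _)
    (cong₂ ⟨_,_⟩ (trans (assoc _ _ _) (cong (f ∘_) (π₁∘⟨⟩ x y)))
                 (trans (assoc _ _ _) (cong (g ∘_) (π₂∘⟨⟩ x y))))

  ⟨⟩-η : ∀ {Z A B} (h : Hom Z (A ⊗ B)) → h ≡ ⟨ π₁ ∘ h , π₂ ∘ h ⟩
  ⟨⟩-η h = ⟨⟩-unique _ _ h refl refl

  factorisation⇒pointwise : ∀ {A B W} {a : Hom A W} {b : Hom B W} →
    FactorsThrough b a → ∀ (u : Point B) → b ∘ u ∈ a
  factorisation⇒pointwise {a = a} {b} (k , ak≡b) u =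
    k ∘ u , trans (sym (assoc a k u)) (cong (_∘ u) ak≡b)

  module WeakPullback (weq : HasWeakEqualisers C)
                      {A B W} (a : Hom A W) (b : Hom B W) where
    private
      equaliser = weq (a ∘ π₁ {A} {B}) (b ∘ π₂)

    E : Obj
    E = proj₁ equaliser

    e : Hom E (A ⊗ B)
    e = proj₁ (proj₂ equaliser)

    e-equalises : (a ∘ π₁) ∘ e ≡ (b ∘ π₂) ∘ e
    e-equalises = proj₁ (proj₂ (proj₂ equaliser))

    e-factor : ∀ {Z} (h : Hom Z (A ⊗ B)) → (a ∘ π₁) ∘ h ≡ (b ∘ π₂) ∘ h →
               Σ (Hom Z E) λ m → e ∘ m ≡ h
    e-factor = proj₂ (proj₂ (proj₂ equaliser))

    p₁ : Hom E A
    p₁ = π₁ ∘ e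

    p₂ : Hom E B
    p₂ = π₂ ∘ e

    square : a ∘ p₁ ≡ b ∘ p₂
    square = begin
      a ∘ (π₁ ∘ e)   ≡⟨ sym (assoc _ _ _) ⟩
      (a ∘ π₁) ∘ e   ≡⟨ e-equalises ⟩
      (b ∘ π₂) ∘ e   ≡⟨ assoc _ _ _ ⟩
      b ∘ (π₂ ∘ e)   ∎
      where open ≡-Reasoning

    pair-equalises : ∀ (v : Point A) (u : Point B) → a ∘ v ≡ b ∘ u →
                     (a ∘ π₁) ∘ ⟨ v , u ⟩ ≡ (b ∘ π₂) ∘ ⟨ v , u ⟩
    pair-equalises v u av≡bu = begin
      (a ∘ π₁) ∘ ⟨ v , u ⟩   ≡⟨ assoc _ _ _ ⟩
      a ∘ (π₁ ∘ ⟨ v , u ⟩)   ≡⟨ cong (a ∘_) (π₁∘⟨⟩ v u) ⟩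
      a ∘ v                  ≡⟨ av≡bu ⟩
      b ∘ u                  ≡⟨ cong (b ∘_) (sym (π₂∘⟨⟩ v u)) ⟩
      b ∘ (π₂ ∘ ⟨ v , u ⟩)   ≡⟨ sym (assoc _ _ _) ⟩
      (b ∘ π₂) ∘ ⟨ v , u ⟩   ∎
      where open ≡-Reasoning

    p₂-surjective : (∀ (u : Point B) → b ∘ u ∈ a) → Surjective C P p₂
    p₂-surjective pointwise u =
      let (v , av≡bu) = pointwise u
          (m , em≡vu) = e-factor ⟨ v , u ⟩ (pair-equalises v u av≡bu)
      in m , (begin
        (π₂ ∘ e) ∘ m         ≡⟨ assoc _ _ _ ⟩
        π₂ ∘ (e ∘ m)         ≡⟨ cong (π₂ ∘_) em≡vu ⟩
        π₂ ∘ ⟨ v , u ⟩       ≡⟨ π₂∘⟨⟩ v u ⟩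
        u                    ∎)
      where open ≡-Reasoning

    section⇒factorisation : (t : Hom B E) → p₂ ∘ t ≡ id → FactorsThrough b a
    section⇒factorisation t p₂t≡id = p₁ ∘ t , (begin
      a ∘ (p₁ ∘ t)   ≡⟨ sym (assoc _ _ _) ⟩
      (a ∘ p₁) ∘ t   ≡⟨ cong (_∘ t) square ⟩
      (b ∘ p₂) ∘ t   ≡⟨ assoc _ _ _ ⟩
      b ∘ (p₂ ∘ t)   ≡⟨ cong (b ∘_) p₂t≡id ⟩
      b ∘ id         ≡⟨ idʳ b ⟩
      b              ∎)
      where open ≡-Reasoning

  factorisation⇔pointwise : HasWeakEqualisers C →
    ∀ {A B W} (a : Hom A W) (b : Hom B W) → ChoiceObject C P B →
    FactorsThrough b a ⇔ (∀ (u : Point B) → b ∘ u ∈ a)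
  factorisation⇔pointwise weq {B = B} a b choice =
    mk⇔ factorisation⇒pointwise pointwise⇒factorisation
    where
      open WeakPullback weq a b
      pointwise⇒factorisation : (∀ (u : Point B) → b ∘ u ∈ a) → FactorsThrough b a
      pointwise⇒factorisation pointwise =
        let (t , p₂t≡id) = choice p₂ (p₂-surjective pointwise)
        in section⇒factorisation t p₂t≡id

  -- The points of (f ⊗₁ f) ∘ r lie in the image of s iff f preserves the
  -- relation ∼ᵣ into ∼ₛ: points of r are the pairs ⟨ x , x' ⟩ with x ∼ᵣ x'.
  pointwise⇔preserves : ∀ {R S X Y} (r : Hom R (X ⊗ X)) (s : Hom S (Y ⊗ Y)) (f : Hom X Y) →
    (∀ (u : Point R) → ((f ⊗₁ f) ∘ r) ∘ u ∈ s) ⇔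
    (∀ (x x' : Point X) → Rel∼ C P r x x' → Rel∼ C P s (f ∘ x) (f ∘ x'))
  pointwise⇔preserves {R} {_} {X} r s f = mk⇔ preserves pointwise
    where
      image-of-pair : ∀ (u : Point R) {x x' : Point X} → r ∘ u ≡ ⟨ x , x' ⟩ →
                      ((f ⊗₁ f) ∘ r) ∘ u ≡ ⟨ f ∘ x , f ∘ x' ⟩
      image-of-pair u {x} {x'} ru≡xx' = begin
        ((f ⊗₁ f) ∘ r) ∘ u     ≡⟨ assoc _ _ _ ⟩
        (f ⊗₁ f) ∘ (r ∘ u)     ≡⟨ cong ((f ⊗₁ f) ∘_) ru≡xx' ⟩
        (f ⊗₁ f) ∘ ⟨ x , x' ⟩  ≡⟨ ⊗₁∘⟨⟩ f f x x' ⟩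
        ⟨ f ∘ x , f ∘ x' ⟩     ∎
        where open ≡-Reasoning

      preserves : (∀ (u : Point R) → ((f ⊗₁ f) ∘ r) ∘ u ∈ s) →
        ∀ (x x' : Point X) → Rel∼ C P r x x' → Rel∼ C P s (f ∘ x) (f ∘ x')
      preserves pointwise x x' (u , ru≡xx') =
        subst (_∈ s) (image-of-pair u ru≡xx') (pointwise u)

      pointwise : (∀ (x x' : Point X) → Rel∼ C P r x x' → Rel∼ C P s (f ∘ x) (f ∘ x')) →
        ∀ (u : Point R) → ((f ⊗₁ f) ∘ r) ∘ u ∈ s
      pointwise preserve u =
        subst (_∈ s) (sym (image-of-pair u (⟨⟩-η (r ∘ u))))
              (preserve (π₁ ∘ (r ∘ u)) (π₂ ∘ (r ∘ u)) (u , ⟨⟩-η (r ∘ u)))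

  pointwise⇔related : ∀ {S X Y} (s : Hom S (Y ⊗ Y)) (f g : Hom X Y) →
    (∀ (x : Point X) → ⟨ f , g ⟩ ∘ x ∈ s) ⇔
    (∀ (x : Point X) → Rel∼ C P s (f ∘ x) (g ∘ x))
  pointwise⇔related s f g = mk⇔
    (λ pointwise x → subst (_∈ s) (⟨⟩∘ f g x) (pointwise x))
    (λ related x → subst (_∈ s) (sym (⟨⟩∘ f g x)) (related x))

corollary3p11 : ∀ {o ℓ : Level} (C : Category o ℓ) (P : FiniteProducts C) →
    HasWeakEqualisers C →
    (∀ (Z : Category.Obj C) → ChoiceObject C P Z) →
    ∀ {R S X Y : Category.Obj C}
    (r : Category.Hom C R (FiniteProducts._⊗_ P X X))
    (s : Category.Hom C S (FiniteProducts._⊗_ P Y Y)) →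
    IsPseudoEquivalence C P r → IsPseudoEquivalence C P s →
    (∀ (f : Category.Hom C X Y) →
    IsExArrow C P r s f ⇔
    (∀ (x x' : Category.Hom C (FiniteProducts.⊤ P) X) →
    Rel∼ C P r x x' →
    Rel∼ C P s (Category._∘_ C f x) (Category._∘_ C f x')))
    ×
    (∀ (f g : Category.Hom C X Y) → IsExArrow C P r s f → IsExArrow C P r s g →
    ExIdentified C P s f g ⇔
    (∀ (x : Category.Hom C (FiniteProducts.⊤ P) X) →
    Rel∼ C P s (Category._∘_ C f x) (Category._∘_ C g x)))
corollary3p11 C P weq choice {R} {_} {X} {Y} r s _ _ = arrows , equality
  where
    open Category C
    open FiniteProducts P
    open Points C P

    arrows : ∀ (f : Hom X Y) → IsExArrow C P r s f ⇔
      (∀ (x x' : Point X) → Rel∼ C P r x x' → Rel∼ C P s (f ∘ x) (f ∘ x'))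
    arrows f = pointwise⇔preserves r s f
               ⇔-∘ factorisation⇔pointwise weq s ((f ⊗₁ f) ∘ r) (choice R)

    equality : ∀ (f g : Hom X Y) → IsExArrow C P r s f → IsExArrow C P r s g →
      ExIdentified C P s f g ⇔ (∀ (x : Point X) → Rel∼ C P s (f ∘ x) (g ∘ x))
    equality f g _ _ = pointwise⇔related s f g
                       ⇔-∘ factorisation⇔pointwise weq s ⟨ f , g ⟩ (choice X)
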